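{- If $G \in \mathcal{N}_{\text{cubic}}^*$, then $Z(G) = \gamma(G) + 2$.
   Context: Diamond-necklace: a diamond is $K_4$ minus one edge. For an integer $k \ge 2$, take $k$ disjoint diamonds $D_1,\dots,D_k$ with $V(D_i)=\{a_i,b_i,c_i,d_i\}$, where $a_ib_i$ is the missing edge of $D_i$. Add the edges $a_ib_{i+1}$ for $i\in\{1,\dots,k-1\}$ and the edge $a_kb_1$. The resulting graph is the diamond-necklace $N_k$. Define $\mathcal{N}_{\text{cubic}}^* = \{N_k : k\ge 2\}\cup\{K_4\}$. $\gamma(G)$ is the domination number of $G$: the minimum size of a set $X$ such that every vertex is in $X$ or adjacent to a vertex of $X$. $Z(G)$ is the zero forcing number of $G$. Start with a set $S$ of vertices colored blue and color all others white. Repeatedly apply the following rule: if a blue vertex has exactly one white neighbor, that neighbor becomes blue. $S$ is a zero forcing set if all vertices eventually become blue. $Z(G)$ is the minimum size of a zero forcing set. -}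

module Defs where

open import Data.Nat using (ℕ; zero; suc; _+_; _*_; _≤_)
open import Data.Fin using (Fin; toℕ; remQuot)
open import Data.Fin.Subset using (Subset; _∈_; ∣_∣)
open import Data.Product using (Σ; _×_; _,_; ∃; proj₁; proj₂)
open import Data.Sum using (_⊎_)
open import Relation.Binary.PropositionalEquality using (_≡_; _≢_)

record Graph : Set₁ where
  field
    n   : ℕ
    Adj : Fin n → Fin n → Set
open Graph public

Dominating : (G : Graph) → Subset (n G) → Set
Dominating G X = ∀ v → v ∈ X ⊎ (∃ λ u → u ∈ X × Adj G u v)

IsDominationNumber : Graph → ℕ → Set
IsDominationNumber G m =
  (∃ λ X → Dominating G X × ∣ X ∣ ≡ m) × (∀ X → Dominating G X → m ≤ ∣ X ∣)

data Blue (G : Graph) (S : Subset (n G)) : Fin (n G) → Set where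
  initial : ∀ {v} → v ∈ S → Blue G S v
  force   : ∀ {u v} → Blue G S u → Adj G u v →
            (∀ w → Adj G u w → w ≢ v → Blue G S w) → Blue G S v

ZeroForcingSet : (G : Graph) → Subset (n G) → Set
ZeroForcingSet G S = ∀ v → Blue G S v

IsZeroForcingNumber : Graph → ℕ → Set
IsZeroForcingNumber G m =
  (∃ λ S → ZeroForcingSet G S × ∣ S ∣ ≡ m) × (∀ S → ZeroForcingSet G S → m ≤ ∣ S ∣)

K4 : Graph
K4 = record { n = 4 ; Adj = λ x y → x ≢ y }

-- Vertex set Fin (k * 4); vertex x corresponds to
-- the pair remQuot 4 x = (i , j) : Fin k × Fin 4, i.e. vertex j of
-- diamond D_(i+1), where j = 0,1,2,3 stands for a,b,c,d.
-- The missing edge of each diamond is a b (j = 0, j' = 1).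

NextMod : (k : ℕ) → Fin k → Fin k → Set
NextMod k i i' = toℕ i' ≡ suc (toℕ i) ⊎ (toℕ i' ≡ 0 × suc (toℕ i) ≡ k)

DiamondAdj : Fin 4 → Fin 4 → Set
DiamondAdj j j' = j ≢ j' × ¬ab j j' × ¬ab j' j
  where
  ¬ab : Fin 4 → Fin 4 → Set
  ¬ab x y = (toℕ x ≡ 0 × toℕ y ≡ 1) → Data.Empty.⊥
    where import Data.Empty

NeckEdge : (k : ℕ) → Fin k × Fin 4 → Fin k × Fin 4 → Set
NeckEdge k (i , j) (i' , j') = NextMod k i i' × toℕ j ≡ 0 × toℕ j' ≡ 1

NecklaceAdj : (k : ℕ) → Fin (k * 4) → Fin (k * 4) → Set
NecklaceAdj k x y =
  let p = remQuot {k} 4 x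
      q = remQuot {k} 4 y
  in (proj₁ p ≡ proj₁ q × DiamondAdj (proj₂ p) (proj₂ q))
     ⊎ NeckEdge k p q ⊎ NeckEdge k q p

Necklace : ℕ → Graph
Necklace k = record { n = k * 4 ; Adj = NecklaceAdj k }

data NCubicStar : Graph → Set₁ where
  necklace : ∀ k → 2 ≤ k → NCubicStar (Necklace k)
  k4       : NCubicStar K4

-- γ(N_k) = k: the closed neighbourhood of c_i lies inside the diamond D_i, so a dominating
-- set meets every diamond, while {c_1, …, c_k} dominates.
--
-- Z(N_k) = k + 2 rests on forts: nonempty sets F such that no vertex outside F has exactly
-- one neighbour in F.  A zero forcing set S meets every fort: the first vertex of F to turn
-- blue would be forced by a blue vertex outside F, whose second neighbour in F is still white.
-- The forts {c_i, d_i} put a vertex of every {c_i, d_i} into S, and the fort of all a's and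
-- b's a further vertex s ∈ {a_i, b_i}.  If some y ∈ {c_i, d_i} is missing from S, the fort
-- obtained from the a's and b's by exchanging s for y yields a second a or b in S; otherwise
-- s, c_i, d_i ∈ S.  Either way |S| ≥ k + 2.  Conversely {a_1, c_1, d_1, c_2, …, c_k} forces:
-- c_1 forces b_1, and diamond by diamond a_i forces b_(i+1), b_(i+1) forces d_(i+1) and
-- c_(i+1) forces a_(i+1).
--
-- K4 is N_1: the cross edge a_1 b_1 of N_1 restores the missing edge of its only diamond.

module Submission where

open import Defs
open import Data.Nat using (ℕ; zero; suc; _+_; _*_; _≤_; z≤n; s≤s)
open import Data.Nat.Properties
  using (≤-antisym; ≤-trans; _<?_; ≮⇒≥; <-irrefl; +-comm; +-monoʳ-≤; module ≤-Reasoning)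
import Data.Nat.Properties as ℕ
open import Data.Fin using (Fin; zero; suc; toℕ; combine; fromℕ<; fromℕ; inject₁)
open import Data.Fin.Properties
  using (_≟_; suc-injective; 0≢1+n; toℕ-injective; toℕ<n; toℕ-fromℕ<; toℕ-fromℕ; toℕ-inject₁;
         combine-remQuot; remQuot-combine; combine-injective)
open import Data.Fin.Subset
  using (Subset; _∈_; _∉_; ∣_∣; _∩_; _∪_; _-_; ⁅_⁆; ∁; Nonempty; Empty; inside; outside)
open import Data.Fin.Induction using (<-weakInduction)
open import Data.Vec using (Vec; []; _∷_; lookup; concat; replicate; here; there)
open import Data.Vec.Properties using (lookup-concat; lookup-replicate; lookup⇒[]=; []=⇒lookup)
open import Data.Fin.Subset.Properties
  using (nonempty?; _∈?_; p─q⊆p; x∈⁅x⁆; x∈⁅y⁆⇒x≡y; x∈p∪q⁺; x∈p∪q⁻; x∈p∩q⁺; x∈p∩q⁻;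
         x∈p∧x≢y⇒x∈p-y; x∈p⇒∣p-x∣<∣p∣)
open import Data.Product using (∃; ∃₂; _×_; _,_; proj₁; proj₂)
open import Data.Sum using (_⊎_; inj₁; inj₂)
open import Data.Empty using (⊥-elim)
open import Function using (_∘_; _∘₂_; _⇔_; mk⇔; Equivalence)
open import Function.Definitions using (Injective)
open import Relation.Nullary using (¬_; yes; no)
open import Relation.Binary.PropositionalEquality
  using (_≡_; _≢_; refl; sym; trans; cong; subst; subst₂; ≢-sym)

-- IsDominationNumber G and IsZeroForcingNumber G unfold to MinimumSize (Dominating G) and
-- MinimumSize (ZeroForcingSet G).
MinimumSize : ∀ {m} → (Subset m → Set) → ℕ → Set
MinimumSize P s = (∃ λ X → P X × ∣ X ∣ ≡ s) × (∀ X → P X → s ≤ ∣ X ∣)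

minimumSize-unique : ∀ {m} {P : Subset m → Set} {s t} →
  MinimumSize P s → MinimumSize P t → s ≡ t
minimumSize-unique ((X , PX , refl) , s-min) ((Y , PY , refl) , t-min) =
  ≤-antisym (s-min Y PY) (t-min X PX)

minimumSize-cong : ∀ {m} {P Q : Subset m → Set} {s} →
  (∀ X → P X ⇔ Q X) → MinimumSize P s → MinimumSize Q s
minimumSize-cong P⇔Q ((X , PX , size) , minimal) =
  (X , Equivalence.to (P⇔Q X) PX , size) , λ Y QY → minimal Y (Equivalence.from (P⇔Q Y) QY)

injection⇒≤∣p∣ : ∀ {m n} {p : Subset n} (f : Fin m → Fin n) →
  Injective _≡_ _≡_ f → (∀ i → f i ∈ p) → m ≤ ∣ p ∣
injection⇒≤∣p∣ {zero} f f-inj f∈p = z≤n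
injection⇒≤∣p∣ {suc m} {p = p} f f-inj f∈p =
  ≤-trans (s≤s (injection⇒≤∣p∣ (f ∘ suc) (suc-injective ∘ f-inj) f∘suc∈p-f₀))
          (x∈p⇒∣p-x∣<∣p∣ (f∈p zero))
  where
  f∘suc∈p-f₀ : ∀ i → f (suc i) ∈ p - f zero
  f∘suc∈p-f₀ i = x∈p∧x≢y⇒x∈p-y (f∈p (suc i)) (λ eq → 0≢1+n (f-inj (sym eq)))

2+∣p-x-y∣≤∣p∣ : ∀ {n} {p : Subset n} {x y} → x ∈ p → y ∈ p → x ≢ y → 2 + ∣ p - x - y ∣ ≤ ∣ p ∣
2+∣p-x-y∣≤∣p∣ x∈p y∈p x≢y =
  ≤-trans (s≤s (x∈p⇒∣p-x∣<∣p∣ (x∈p∧x≢y⇒x∈p-y y∈p (≢-sym x≢y)))) (x∈p⇒∣p-x∣<∣p∣ x∈p)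

x∉p-x : ∀ {n} {p : Subset n} (x : Fin n) → x ∉ p - x
x∉p-x {p = _ ∷ _} zero ()
x∉p-x {p = _ ∷ _} (suc x) (there x∈p-x) = x∉p-x x x∈p-x

Fort : (G : Graph) → Subset (n G) → Set
Fort G F = ∀ {u v} → u ∉ F → v ∈ F → Adj G u v → ∃ λ w → w ∈ F × Adj G u w × w ≢ v

module _ (G : Graph) {S F : Subset (n G)} (fort : Fort G F) where

  blue∉fort : Empty (S ∩ F) → ∀ {v} → Blue G S v → v ∉ F
  blue∉fort S∩F-empty (initial v∈S) v∈F = S∩F-empty (_ , x∈p∩q⁺ (v∈S , v∈F))
  blue∉fort S∩F-empty (force u-blue uv others-blue) v∈F
    with fort (blue∉fort S∩F-empty u-blue) v∈F uv
  ... | w , w∈F , uw , w≢v = blue∉fort S∩F-empty (others-blue _ uw w≢v) w∈F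

  zeroForcingSet-meets-fort : ZeroForcingSet G S → Nonempty F → Nonempty (S ∩ F)
  zeroForcingSet-meets-fort zfs (v , v∈F) with nonempty? (S ∩ F)
  ... | yes S∩F-nonempty = S∩F-nonempty
  ... | no S∩F-empty = ⊥-elim (blue∉fort S∩F-empty (zfs v) v∈F)

fort-by-two-neighbours : (G : Graph) {F : Subset (n G)} →
  (∀ {u v} → u ∉ F → v ∈ F → Adj G u v →
     ∃₂ λ w₁ w₂ → w₁ ≢ w₂ × (w₁ ∈ F × Adj G u w₁) × (w₂ ∈ F × Adj G u w₂)) →
  Fort G F
fort-by-two-neighbours G two {v = v} u∉F v∈F uv with two u∉F v∈F uv
... | w₁ , w₂ , w₁≢w₂ , (w₁∈F , uw₁) , (w₂∈F , uw₂) with w₁ ≟ v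
...   | yes refl = w₂ , w₂∈F , uw₂ , ≢-sym w₁≢w₂
...   | no w₁≢v = w₁ , w₁∈F , uw₁ , w₁≢v

module _ (G : Graph) {E : Fin (n G) → Fin (n G) → Set} where

  dominating-mono : (∀ {u v} → Adj G u v → E u v) →
    ∀ {X} → Dominating G X → Dominating (record G { Adj = E }) X
  dominating-mono G⇒E dom v with dom v
  ... | inj₁ v∈X = inj₁ v∈X
  ... | inj₂ (u , u∈X , uv) = inj₂ (u , u∈X , G⇒E uv)

  blue-mono : (∀ {u v} → Adj G u v → E u v) → (∀ {u v} → E u v → Adj G u v) →
    ∀ {S v} → Blue G S v → Blue (record G { Adj = E }) S v
  blue-mono G⇒E E⇒G (initial v∈S) = initial v∈S
  blue-mono G⇒E E⇒G (force u-blue uv others-blue) =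
    force (blue-mono G⇒E E⇒G u-blue) (G⇒E uv)
          (λ w uw w≢v → blue-mono G⇒E E⇒G (others-blue w (E⇒G uw) w≢v))

module _ (G : Graph) {E : Fin (n G) → Fin (n G) → Set} (G⇔E : ∀ {u v} → Adj G u v ⇔ E u v) where

  private
    H : Graph
    H = record G { Adj = E }
    G⇒E : ∀ {u v} → Adj G u v → E u v
    G⇒E = Equivalence.to G⇔E
    E⇒G : ∀ {u v} → E u v → Adj G u v
    E⇒G = Equivalence.from G⇔E

  dominationNumber-transfer : ∀ {s} → IsDominationNumber G s → IsDominationNumber H s
  dominationNumber-transfer = minimumSize-cong λ X →
    mk⇔ (dominating-mono G G⇒E) (dominating-mono H E⇒G)

  zeroForcingNumber-transfer : ∀ {s} → IsZeroForcingNumber G s → IsZeroForcingNumber H s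
  zeroForcingNumber-transfer = minimumSize-cong λ S →
    mk⇔ (λ zfs v → blue-mono G G⇒E E⇒G (zfs v)) (λ zfs v → blue-mono H E⇒G G⇒E (zfs v))

pattern a = zero
pattern b = suc zero
pattern c = suc (suc zero)
pattern d = suc (suc (suc zero))

-- a and b are the ends of the missing edge; c and d are adjacent to the whole diamond.
data Tip : Fin 4 → Set where
  a-tip : Tip a
  b-tip : Tip b

data Spine : Fin 4 → Set where
  c-spine : Spine c
  d-spine : Spine d

tip-or-spine : ∀ j → Tip j ⊎ Spine j
tip-or-spine a = inj₁ a-tip
tip-or-spine b = inj₁ b-tip
tip-or-spine c = inj₂ c-spine
tip-or-spine d = inj₂ d-spine

tip≢spine : ∀ {j j'} → Tip j → Spine j' → j ≢ j'
tip≢spine a-tip c-spine ()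
tip≢spine a-tip d-spine ()
tip≢spine b-tip c-spine ()
tip≢spine b-tip d-spine ()

diamondAdj-spine : ∀ {j j'} → Spine j ⊎ Spine j' → j ≢ j' → DiamondAdj j j'
diamondAdj-spine (inj₁ c-spine) j≢j' = j≢j' , (λ { (() , _) }) , (λ { (_ , ()) })
diamondAdj-spine (inj₁ d-spine) j≢j' = j≢j' , (λ { (() , _) }) , (λ { (_ , ()) })
diamondAdj-spine (inj₂ c-spine) j≢j' = j≢j' , (λ { (_ , ()) }) , (λ { (() , _) })
diamondAdj-spine (inj₂ d-spine) j≢j' = j≢j' , (λ { (_ , ()) }) , (λ { (() , _) })

ab : Subset 4
ab = inside ∷ inside ∷ outside ∷ outside ∷ []

tip⇒∈ab : ∀ {j} → Tip j → j ∈ ab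
tip⇒∈ab a-tip = here
tip⇒∈ab b-tip = there here

∈ab⇒tip : ∀ {j} → j ∈ ab → Tip j
∈ab⇒tip here = a-tip
∈ab⇒tip (there here) = b-tip
∈ab⇒tip (there (there (there (there ()))))

module _ {k : ℕ} where

  NextMod-functional : ∀ {i i' i''} → NextMod k i i' → NextMod k i i'' → i' ≡ i''
  NextMod-functional (inj₁ p) (inj₁ q) = toℕ-injective (trans p (sym q))
  NextMod-functional {i' = i'} (inj₁ p) (inj₂ (_ , q)) = ⊥-elim (<-irrefl (trans p q) (toℕ<n i'))
  NextMod-functional {i'' = i''} (inj₂ (_ , p)) (inj₁ q) = ⊥-elim (<-irrefl (trans q p) (toℕ<n i''))
  NextMod-functional (inj₂ (p , _)) (inj₂ (q , _)) = toℕ-injective (trans p (sym q))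

  NextMod-injective : ∀ {i i' i''} → NextMod k i' i → NextMod k i'' i → i' ≡ i''
  NextMod-injective (inj₁ p) (inj₁ q) = toℕ-injective (ℕ.suc-injective (trans (sym p) q))
  NextMod-injective (inj₁ p) (inj₂ (q , _)) with () ← trans (sym p) q
  NextMod-injective (inj₂ (p , _)) (inj₁ q) with () ← trans (sym q) p
  NextMod-injective (inj₂ (_ , p)) (inj₂ (_ , q)) = toℕ-injective (ℕ.suc-injective (trans p (sym q)))

next : ∀ {k} i → ∃ (NextMod k i)
next {suc m} i with suc (toℕ i) <? suc m
... | yes i+1<k = fromℕ< i+1<k , inj₁ (toℕ-fromℕ< i+1<k)
... | no i+1≮k = zero , inj₂ (refl , ≤-antisym (toℕ<n i) (≮⇒≥ i+1≮k))

previous : ∀ {k} i → ∃ λ i' → NextMod k i' i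
previous {suc m} zero = fromℕ m , inj₂ (refl , cong suc (toℕ-fromℕ m))
previous {suc m} (suc i) = inject₁ i , inj₁ (cong suc (sym (toℕ-inject₁ i)))

c-vertices : ∀ k → Subset (k * 4)
c-vertices k = concat (replicate k ⁅ c ⁆)

∣c-vertices∣ : ∀ k → ∣ c-vertices k ∣ ≡ k
∣c-vertices∣ zero = refl
∣c-vertices∣ (suc k) = cong suc (∣c-vertices∣ k)

module NecklaceGraph {k : ℕ} where

  Vertex : Set
  Vertex = Fin (k * 4)

  vertex : Fin k → Fin 4 → Vertex
  vertex = combine

  data Decomposition : Vertex → Set where
    at : ∀ i j → Decomposition (vertex i j)

  decompose : ∀ v → Decomposition v
  decompose v = subst Decomposition (combine-remQuot {k} 4 v) (at _ _)

  vertex-injective : ∀ i j i' j' → vertex i j ≡ vertex i' j' → i ≡ i' × j ≡ j'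
  vertex-injective = combine-injective

  vertex-≢ˡ : ∀ {i i' j j'} → i ≢ i' → vertex i j ≢ vertex i' j'
  vertex-≢ˡ i≢i' = i≢i' ∘ proj₁ ∘ vertex-injective _ _ _ _

  vertex-≢ʳ : ∀ {i i' j j'} → j ≢ j' → vertex i j ≢ vertex i' j'
  vertex-≢ʳ j≢j' = j≢j' ∘ proj₂ ∘ vertex-injective _ _ _ _

  infix 4 _∼_

  data _∼_ : Fin k × Fin 4 → Fin k × Fin 4 → Set where
    diamond : ∀ {i j j'} → DiamondAdj j j' → (i , j) ∼ (i , j')
    right   : ∀ {i i'} → NextMod k i i' → (i , a) ∼ (i' , b)
    left    : ∀ {i i'} → NextMod k i' i → (i , b) ∼ (i' , a)

  private
    -- NecklaceAdj k x y unfolds to PairAdj (remQuot 4 x) (remQuot 4 y).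
    PairAdj : Fin k × Fin 4 → Fin k × Fin 4 → Set
    PairAdj p q = (proj₁ p ≡ proj₁ q × DiamondAdj (proj₂ p) (proj₂ q)) ⊎ NeckEdge k p q ⊎ NeckEdge k q p

    pairAdj⇒∼ : ∀ {i i' j j'} → PairAdj (i , j) (i' , j') → (i , j) ∼ (i' , j')
    pairAdj⇒∼ (inj₁ (refl , jj')) = diamond jj'
    pairAdj⇒∼ {j = a} {j' = b} (inj₂ (inj₁ (ii' , _))) = right ii'
    pairAdj⇒∼ {j = suc _} (inj₂ (inj₁ (_ , () , _)))
    pairAdj⇒∼ {j' = zero} (inj₂ (inj₁ (_ , _ , ())))
    pairAdj⇒∼ {j' = suc (suc _)} (inj₂ (inj₁ (_ , _ , ())))
    pairAdj⇒∼ {j = b} {j' = a} (inj₂ (inj₂ (i'i , _))) = left i'i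
    pairAdj⇒∼ {j' = suc _} (inj₂ (inj₂ (_ , () , _)))
    pairAdj⇒∼ {j = zero} (inj₂ (inj₂ (_ , _ , ())))
    pairAdj⇒∼ {j = suc (suc _)} (inj₂ (inj₂ (_ , _ , ())))

    ∼⇒pairAdj : ∀ {i i' j j'} → (i , j) ∼ (i' , j') → PairAdj (i , j) (i' , j')
    ∼⇒pairAdj (diamond jj') = inj₁ (refl , jj')
    ∼⇒pairAdj (right ii') = inj₂ (inj₁ (ii' , refl , refl))
    ∼⇒pairAdj (left i'i) = inj₂ (inj₂ (i'i , refl , refl))

  adj⇒∼ : ∀ {i i' j j'} → Adj (Necklace k) (vertex i j) (vertex i' j') → (i , j) ∼ (i' , j')
  adj⇒∼ {i} {i'} {j} {j'} = pairAdj⇒∼ ∘ subst₂ PairAdj (remQuot-combine i j) (remQuot-combine i' j')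

  ∼⇒adj : ∀ {i i' j j'} → (i , j) ∼ (i' , j') → Adj (Necklace k) (vertex i j) (vertex i' j')
  ∼⇒adj {i} {i'} {j} {j'} =
    subst₂ PairAdj (sym (remQuot-combine i j)) (sym (remQuot-combine i' j')) ∘ ∼⇒pairAdj

  ∼-irrefl : ∀ {p} → ¬ p ∼ p
  ∼-irrefl (diamond (j≢j , _)) = j≢j refl

  adj-irrefl : ∀ {v} → ¬ Adj (Necklace k) v v
  adj-irrefl {v} with decompose v
  ... | at i j = ∼-irrefl ∘ adj⇒∼

  ∼-sym : ∀ {p q} → p ∼ q → q ∼ p
  ∼-sym (diamond (j≢j' , ¬jj' , ¬j'j)) = diamond (≢-sym j≢j' , ¬j'j , ¬jj')
  ∼-sym (right ii') = left ii'
  ∼-sym (left i'i) = right i'i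

  ∼-spine : ∀ {i j j'} → Spine j ⊎ Spine j' → j ≢ j' → (i , j) ∼ (i , j')
  ∼-spine = diamond ∘₂ diamondAdj-spine

  spine∼tip : ∀ {i j j'} → Spine j → Tip j' → (i , j) ∼ (i , j')
  spine∼tip j-spine j'-tip = ∼-spine (inj₁ j-spine) (≢-sym (tip≢spine j'-tip j-spine))

  tip∼spine : ∀ {i j j'} → Tip j → Spine j' → (i , j) ∼ (i , j')
  tip∼spine j-tip j'-spine = ∼-spine (inj₂ j'-spine) (tip≢spine j-tip j'-spine)

  ∼spine⇒sameBlock : ∀ {i i' j j'} → (i' , j') ∼ (i , j) → Spine j → i' ≡ i
  ∼spine⇒sameBlock (diamond _) _ = refl

  cross-neighbour : ∀ i {j} → Tip j → ∃₂ λ i' j' → Tip j' × j' ≢ j × (i , j) ∼ (i' , j')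
  cross-neighbour i a-tip = proj₁ (next i) , b , b-tip , (λ ()) , right (proj₂ (next i))
  cross-neighbour i b-tip = proj₁ (previous i) , a , a-tip , (λ ()) , left (proj₂ (previous i))

  ∈-concat⁺ : ∀ (bs : Vec (Subset 4) k) i {j} → j ∈ lookup bs i → vertex i j ∈ concat bs
  ∈-concat⁺ bs i {j} j∈ = lookup⇒[]= _ _ (trans (lookup-concat bs i j) ([]=⇒lookup j∈))

  ∈-concat⁻ : ∀ (bs : Vec (Subset 4) k) i {j} → vertex i j ∈ concat bs → j ∈ lookup bs i
  ∈-concat⁻ bs i {j} v∈ = lookup⇒[]= _ _ (trans (sym (lookup-concat bs i j)) ([]=⇒lookup v∈))

  ∈-replicate⁺ : ∀ {q} i {j} → j ∈ q → vertex i j ∈ concat (replicate k q)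
  ∈-replicate⁺ {q} i j∈q = ∈-concat⁺ (replicate k q) i (subst (_ ∈_) (sym (lookup-replicate i q)) j∈q)

  ∈-replicate⁻ : ∀ {q} i {j} → vertex i j ∈ concat (replicate k q) → j ∈ q
  ∈-replicate⁻ {q} i v∈ = subst (_ ∈_) (lookup-replicate i q) (∈-concat⁻ (replicate k q) i v∈)

  tips : Subset (k * 4)
  tips = concat (replicate k ab)

  tip∈tips : ∀ i {j} → Tip j → vertex i j ∈ tips
  tip∈tips i = ∈-replicate⁺ i ∘ tip⇒∈ab

  ∈tips⇒tip : ∀ i {j} → vertex i j ∈ tips → Tip j
  ∈tips⇒tip i = ∈ab⇒tip ∘ ∈-replicate⁻ i

  one-per-block⇒k≤∣p∣ : ∀ {p} → (∀ i → ∃ λ j → vertex i j ∈ p) → k ≤ ∣ p ∣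
  one-per-block⇒k≤∣p∣ member =
    injection⇒≤∣p∣ (λ i → vertex i (proj₁ (member i))) (proj₁ ∘ vertex-injective _ _ _ _) (proj₂ ∘ member)

  c-vertices-dominating : Dominating (Necklace k) (c-vertices k)
  c-vertices-dominating v with decompose v
  ... | at i j with j ≟ c
  ...   | yes refl = inj₁ (∈-replicate⁺ i (x∈⁅x⁆ c))
  ...   | no j≢c = inj₂ (vertex i c , ∈-replicate⁺ i (x∈⁅x⁆ c) , ∼⇒adj (∼-spine (inj₁ c-spine) (≢-sym j≢c)))

  dominating⇒k≤∣X∣ : ∀ {X} → Dominating (Necklace k) X → k ≤ ∣ X ∣
  dominating⇒k≤∣X∣ {X} dom = one-per-block⇒k≤∣p∣ λ i → member-of-block i (dom (vertex i c))
    where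
    member-of-block : ∀ i → vertex i c ∈ X ⊎ (∃ λ u → u ∈ X × Adj (Necklace k) u (vertex i c)) →
      ∃ λ j → vertex i j ∈ X
    member-of-block i (inj₁ v∈X) = c , v∈X
    member-of-block i (inj₂ (u , u∈X , uv)) with decompose u
    ... | at i' j' with refl ← ∼spine⇒sameBlock {i = i} (adj⇒∼ uv) c-spine = j' , u∈X

  dominationNumber : IsDominationNumber (Necklace k) k
  dominationNumber = (c-vertices k , c-vertices-dominating , ∣c-vertices∣ k) , λ X → dominating⇒k≤∣X∣

  data TwoNeighboursIn (F : Subset (k * 4)) (i : Fin k) (j : Fin 4) : Set where
    two : ∀ {i₁ j₁ i₂ j₂} → j₁ ≢ j₂ →
          (i , j) ∼ (i₁ , j₁) → vertex i₁ j₁ ∈ F → (i , j) ∼ (i₂ , j₂) → vertex i₂ j₂ ∈ F →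
          TwoNeighboursIn F i j

  necklace-fort : ∀ {F} →
    (∀ {i j i' j'} → vertex i j ∉ F → vertex i' j' ∈ F → (i , j) ∼ (i' , j') → TwoNeighboursIn F i j) →
    Fort (Necklace k) F
  necklace-fort {F} two-in = fort-by-two-neighbours (Necklace k) two-around
    where
    two-around : ∀ {u v} → u ∉ F → v ∈ F → Adj (Necklace k) u v →
      ∃₂ λ w₁ w₂ → w₁ ≢ w₂ × (w₁ ∈ F × Adj (Necklace k) u w₁) × (w₂ ∈ F × Adj (Necklace k) u w₂)
    two-around {u} {v} u∉F v∈F uv with decompose u | decompose v
    ... | at i j | at i' j' with two-in u∉F v∈F (adj⇒∼ uv)
    ... | two j₁≢j₂ e₁ w₁∈F e₂ w₂∈F = _ , _ , vertex-≢ʳ j₁≢j₂ , (w₁∈F , ∼⇒adj e₁) , (w₂∈F , ∼⇒adj e₂)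

  spine-pair : Fin k → Subset (k * 4)
  spine-pair i = ⁅ vertex i c ⁆ ∪ ⁅ vertex i d ⁆

  spine∈spine-pair : ∀ i {j} → Spine j → vertex i j ∈ spine-pair i
  spine∈spine-pair i c-spine = x∈p∪q⁺ (inj₁ (x∈⁅x⁆ _))
  spine∈spine-pair i d-spine = x∈p∪q⁺ (inj₂ (x∈⁅x⁆ _))

  ∈spine-pair⇒ : ∀ {i i' j'} → vertex i' j' ∈ spine-pair i → i' ≡ i × Spine j'
  ∈spine-pair⇒ {i} {i'} {j'} v∈F with x∈p∪q⁻ ⁅ vertex i c ⁆ _ v∈F
  ... | inj₁ v∈⁅c⁆ with refl , refl ← vertex-injective i' j' i c (x∈⁅y⁆⇒x≡y _ v∈⁅c⁆) = refl , c-spine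
  ... | inj₂ v∈⁅d⁆ with refl , refl ← vertex-injective i' j' i d (x∈⁅y⁆⇒x≡y _ v∈⁅d⁆) = refl , d-spine

  spine-fort : ∀ i → Fort (Necklace k) (spine-pair i)
  spine-fort i = necklace-fort two-in
    where
    two-in : ∀ {i₀ j i' j'} → vertex i₀ j ∉ spine-pair i → vertex i' j' ∈ spine-pair i →
      (i₀ , j) ∼ (i' , j') → TwoNeighboursIn (spine-pair i) i₀ j
    two-in {j = j} u∉F v∈F e with ∈spine-pair⇒ v∈F
    ... | refl , j'-spine with refl ← ∼spine⇒sameBlock e j'-spine with tip-or-spine j
    ...   | inj₁ j-tip = two (λ ()) (tip∼spine j-tip c-spine) (spine∈spine-pair i c-spine)
                                    (tip∼spine j-tip d-spine) (spine∈spine-pair i d-spine)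
    ...   | inj₂ j-spine = ⊥-elim (u∉F (spine∈spine-pair i j-spine))

  tips-fort : Fort (Necklace k) tips
  tips-fort = necklace-fort two-in
    where
    two-in : ∀ {i j i' j'} → vertex i j ∉ tips → vertex i' j' ∈ tips → (i , j) ∼ (i' , j') →
      TwoNeighboursIn tips i j
    two-in {i} {j} u∉F _ _ with tip-or-spine j
    ... | inj₁ j-tip = ⊥-elim (u∉F (tip∈tips i j-tip))
    ... | inj₂ j-spine =
      two (λ ()) (spine∼tip j-spine a-tip) (tip∈tips i a-tip)
                 (spine∼tip j-spine b-tip) (tip∈tips i b-tip)

  tips-swapped : Fin k → Fin 4 → Fin 4 → Subset (k * 4)
  tips-swapped i js jy = (tips - vertex i js) ∪ ⁅ vertex i jy ⁆

  swapped-fort : ∀ i {js jy} → Tip js → Spine jy → Fort (Necklace k) (tips-swapped i js jy)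
  swapped-fort i {js} {jy} js-tip jy-spine = necklace-fort two-in
    where
    F : Subset (k * 4)
    F = tips-swapped i js jy
    tip∈F : ∀ {i' j'} → Tip j' → vertex i' j' ≢ vertex i js → vertex i' j' ∈ F
    tip∈F {i'} j'-tip u≢s = x∈p∪q⁺ (inj₁ (x∈p∧x≢y⇒x∈p-y (tip∈tips i' j'-tip) u≢s))
    y∈F : vertex i jy ∈ F
    y∈F = x∈p∪q⁺ (inj₂ (x∈⁅x⁆ _))
    other-tip : ∀ {j} → Tip j → ∃ λ j' → Tip j' × j' ≢ j
    other-tip a-tip = b , b-tip , λ ()
    other-tip b-tip = a , a-tip , λ ()
    two-in : ∀ {i' j' i'' j''} → vertex i' j' ∉ F → vertex i'' j'' ∈ F → (i' , j') ∼ (i'' , j'') →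
      TwoNeighboursIn F i' j'
    two-in {i'} {j'} u∉F _ _ with tip-or-spine j'
    ... | inj₁ j'-tip with vertex i' j' ≟ vertex i js
    ...   | no u≢s = ⊥-elim (u∉F (tip∈F j'-tip u≢s))
    ...   | yes u≡s with refl , refl ← vertex-injective i' j' i js u≡s with cross-neighbour i js-tip
    ...     | _ , _ , jx-tip , jx≢js , e =
      two (≢-sym (tip≢spine jx-tip jy-spine)) (tip∼spine js-tip jy-spine) y∈F
                                               e (tip∈F jx-tip (vertex-≢ʳ jx≢js))
    two-in {i'} {j'} u∉F _ _ | inj₂ j'-spine with i' ≟ i
    ... | no i'≢i =
      two (λ ()) (spine∼tip j'-spine a-tip) (tip∈F a-tip (vertex-≢ˡ i'≢i))
                 (spine∼tip j'-spine b-tip) (tip∈F b-tip (vertex-≢ˡ i'≢i))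
    ... | yes refl with j' ≟ jy | other-tip js-tip
    ...   | yes refl | _ = ⊥-elim (u∉F y∈F)
    ...   | no j'≢jy | jo , jo-tip , jo≢js =
      two (tip≢spine jo-tip jy-spine) (spine∼tip j'-spine jo-tip) (tip∈F jo-tip (vertex-≢ʳ jo≢js))
                                      (∼-spine (inj₁ j'-spine) j'≢jy) y∈F

  surplus⇒k+2≤∣S∣ : ∀ {S x y} → x ∈ S → y ∈ S → x ≢ y → (∀ i → ∃ λ j → vertex i j ∈ S - x - y) →
    k + 2 ≤ ∣ S ∣
  surplus⇒k+2≤∣S∣ {S} {x} {y} x∈S y∈S x≢y member = begin
    k + 2             ≡⟨ +-comm k 2 ⟩
    2 + k             ≤⟨ +-monoʳ-≤ 2 (one-per-block⇒k≤∣p∣ member) ⟩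
    2 + ∣ S - x - y ∣  ≤⟨ 2+∣p-x-y∣≤∣p∣ x∈S y∈S x≢y ⟩
    ∣ S ∣             ∎
    where open ≤-Reasoning

  module _ {S : Subset (k * 4)} (zfs : ZeroForcingSet (Necklace k) S) where

    spine-hit : ∀ i → ∃ λ j → Spine j × vertex i j ∈ S
    spine-hit i
      with zeroForcingSet-meets-fort (Necklace k) (spine-fort i) zfs (vertex i c , spine∈spine-pair i c-spine)
    ... | u , u∈S∩F with x∈p∩q⁻ S _ u∈S∩F | decompose u
    ... | u∈S , u∈F | at _ j with refl , j-spine ← ∈spine-pair⇒ u∈F = j , j-spine , u∈S

    tip-hit : Fin k → ∃₂ λ i j → Tip j × vertex i j ∈ S
    tip-hit i₀ with zeroForcingSet-meets-fort (Necklace k) tips-fort zfs (vertex i₀ a , tip∈tips i₀ a-tip)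
    ... | u , u∈S∩F with x∈p∩q⁻ S _ u∈S∩F | decompose u
    ... | u∈S , u∈tips | at i j = i , j , ∈tips⇒tip i u∈tips , u∈S

    swapped-hit : ∀ {i js jy} → Tip js → Spine jy → vertex i jy ∉ S →
      ∃₂ λ i' j' → Tip j' × vertex i' j' ∈ S × vertex i' j' ≢ vertex i js
    swapped-hit {i} {js} {jy} js-tip jy-spine y∉S
      with zeroForcingSet-meets-fort (Necklace k) (swapped-fort i js-tip jy-spine) zfs
             (vertex i jy , x∈p∪q⁺ (inj₂ (x∈⁅x⁆ _)))
    ... | u , u∈S∩F with x∈p∩q⁻ S _ u∈S∩F
    ... | u∈S , u∈F with x∈p∪q⁻ (tips - vertex i js) _ u∈F
    ...   | inj₂ u∈⁅y⁆ rewrite x∈⁅y⁆⇒x≡y _ u∈⁅y⁆ = ⊥-elim (y∉S u∈S)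
    ...   | inj₁ u∈tips-s with decompose u
    ...     | at i' j' = i' , j' , ∈tips⇒tip i' (p─q⊆p _ _ u∈tips-s) , u∈S ,
                         λ u≡s → x∉p-x _ (subst (_∈ tips - vertex i js) u≡s u∈tips-s)

    private
      ∈S-x-y : ∀ {u x y} → u ∈ S → u ≢ x → u ≢ y → u ∈ S - x - y
      ∈S-x-y u∈S u≢x u≢y = x∈p∧x≢y⇒x∈p-y (x∈p∧x≢y⇒x∈p-y u∈S u≢x) u≢y

    two-tips⇒k+2≤∣S∣ : ∀ {i j i' j'} → Tip j → Tip j' → vertex i j ∈ S → vertex i' j' ∈ S →
      vertex i j ≢ vertex i' j' → k + 2 ≤ ∣ S ∣
    two-tips⇒k+2≤∣S∣ j-tip j'-tip s∈S s'∈S s≢s' = surplus⇒k+2≤∣S∣ s∈S s'∈S s≢s' λ i'' →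
      let (j'' , j''-spine , v∈S) = spine-hit i'' in
      j'' , ∈S-x-y v∈S (vertex-≢ʳ (≢-sym (tip≢spine j-tip j''-spine)))
                       (vertex-≢ʳ (≢-sym (tip≢spine j'-tip j''-spine)))

    full-diamond⇒k+2≤∣S∣ : ∀ {i j} → Tip j → vertex i j ∈ S → vertex i c ∈ S → vertex i d ∈ S →
      k + 2 ≤ ∣ S ∣
    full-diamond⇒k+2≤∣S∣ {i} j-tip s∈S c∈S d∈S =
      surplus⇒k+2≤∣S∣ s∈S c∈S (vertex-≢ʳ (tip≢spine j-tip c-spine)) member
      where
      member : ∀ i' → ∃ λ j' → vertex i' j' ∈ S - _ - vertex i c
      member i' with i' ≟ i
      ... | yes refl = d , ∈S-x-y d∈S (vertex-≢ʳ (≢-sym (tip≢spine j-tip d-spine))) (vertex-≢ʳ λ ())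
      ... | no i'≢i =
        let (j' , j'-spine , v∈S) = spine-hit i' in
        j' , ∈S-x-y v∈S (vertex-≢ʳ (≢-sym (tip≢spine j-tip j'-spine))) (vertex-≢ˡ i'≢i)

    -- The block i₀ only witnesses k ≥ 1: N_0 is empty and Z(N_0) = 0.
    zeroForcingSet⇒k+2≤∣S∣ : Fin k → k + 2 ≤ ∣ S ∣
    zeroForcingSet⇒k+2≤∣S∣ i₀ with tip-hit i₀
    ... | i , js , js-tip , s∈S with vertex i c ∈? S | vertex i d ∈? S
    ...   | yes c∈S | yes d∈S = full-diamond⇒k+2≤∣S∣ js-tip s∈S c∈S d∈S
    ...   | no c∉S | _ = let (_ , _ , j'-tip , s'∈S , s'≢s) = swapped-hit js-tip c-spine c∉S in
                         two-tips⇒k+2≤∣S∣ js-tip j'-tip s∈S s'∈S (≢-sym s'≢s)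
    ...   | _ | no d∉S = let (_ , _ , j'-tip , s'∈S , s'≢s) = swapped-hit js-tip d-spine d∉S in
                         two-tips⇒k+2≤∣S∣ js-tip j'-tip s∈S s'∈S (≢-sym s'≢s)

  module _ {S : Subset (k * 4)} where

    force-along : ∀ {i j i' j'} → Blue (Necklace k) S (vertex i j) → (i , j) ∼ (i' , j') →
      (∀ {i'' j''} → (i , j) ∼ (i'' , j'') → (i'' , j'') ≢ (i' , j') →
         Blue (Necklace k) S (vertex i'' j'')) →
      Blue (Necklace k) S (vertex i' j')
    force-along {i} {j} {i'} {j'} u-blue e others-blue = force u-blue (∼⇒adj e) others-blue′
      where
      others-blue′ : ∀ w → Adj (Necklace k) (vertex i j) w → w ≢ vertex i' j' → Blue (Necklace k) S w
      others-blue′ w uw w≢v with decompose w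
      ... | at i'' j'' = others-blue (adj⇒∼ uw) (w≢v ∘ cong (λ (i , j) → vertex i j))

    force-from-spine : ∀ i {j₀ j} → Spine j₀ → j₀ ≢ j → Blue (Necklace k) S (vertex i j₀) →
      (∀ j' → j' ≢ j₀ → j' ≢ j → Blue (Necklace k) S (vertex i j')) → Blue (Necklace k) S (vertex i j)
    force-from-spine i {j₀} {j} j₀-spine j₀≢j spine-blue mates-blue =
      force-along spine-blue (∼-spine (inj₁ j₀-spine) j₀≢j) others-blue
      where
      others-blue : ∀ {i'' j''} → (i , j₀) ∼ (i'' , j'') → (i'' , j'') ≢ (i , j) →
        Blue (Necklace k) S (vertex i'' j'')
      others-blue e ne with refl ← ∼spine⇒sameBlock (∼-sym e) j₀-spine =
        mates-blue _ (λ { refl → ∼-irrefl e }) (ne ∘ cong (i ,_))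

module _ (k' : ℕ) where

  private
    k : ℕ
    k = suc k'

  open NecklaceGraph {k}

  initial-blocks : Vec (Subset 4) k
  initial-blocks = ∁ ⁅ b ⁆ ∷ replicate k' ⁅ c ⁆

  initial-set : Subset (k * 4)
  initial-set = concat initial-blocks

  ∣initial-set∣ : ∣ initial-set ∣ ≡ k + 2
  ∣initial-set∣ = trans (cong (3 +_) (∣c-vertices∣ k')) (cong suc (+-comm 2 k'))

  private
    Blue₀ : Vertex → Set
    Blue₀ = Blue (Necklace k) initial-set

    BlueBlock : Fin k → Set
    BlueBlock i = ∀ j → Blue₀ (vertex i j)

    first-block-initial : ∀ {j} → j ≢ b → Blue₀ (vertex zero j)
    first-block-initial {a} _ = initial (∈-concat⁺ initial-blocks zero here)
    first-block-initial {b} j≢b = ⊥-elim (j≢b refl)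
    first-block-initial {c} _ = initial (∈-concat⁺ initial-blocks zero (there (there here)))
    first-block-initial {d} _ = initial (∈-concat⁺ initial-blocks zero (there (there (there here))))

    c-initial : ∀ i → Blue₀ (vertex i c)
    c-initial zero = first-block-initial λ ()
    c-initial (suc i) = initial (∈-concat⁺ initial-blocks (suc i)
                          (subst (c ∈_) (sym (lookup-replicate i ⁅ c ⁆)) (x∈⁅x⁆ c)))

    first-block-blue : BlueBlock zero
    first-block-blue b =
      force-from-spine zero c-spine (λ ()) (c-initial zero) λ _ _ j'≢b → first-block-initial j'≢b
    first-block-blue a = first-block-initial λ ()
    first-block-blue c = first-block-initial λ ()
    first-block-blue d = first-block-initial λ ()

    next-block-blue : ∀ {i i'} → NextMod k i i' → BlueBlock i → BlueBlock i'
    next-block-blue {i} {i'} ii' block-blue =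
      λ { a → a'-blue ; b → b'-blue ; c → c-initial i' ; d → d'-blue }
      where
      b'-blue : Blue₀ (vertex i' b)
      b'-blue = force-along (block-blue a) (right ii') others-blue
        where
        others-blue : ∀ {i'' j''} → (i , a) ∼ (i'' , j'') → (i'' , j'') ≢ (i' , b) → Blue₀ (vertex i'' j'')
        others-blue (diamond _) _ = block-blue _
        others-blue (right ii'') ne = ⊥-elim (ne (cong (_, b) (NextMod-functional ii'' ii')))
      d'-blue : Blue₀ (vertex i' d)
      d'-blue = force-along b'-blue (tip∼spine b-tip d-spine) others-blue
        where
        others-blue : ∀ {i'' j''} → (i' , b) ∼ (i'' , j'') → (i'' , j'') ≢ (i' , d) → Blue₀ (vertex i'' j'')
        others-blue (diamond {j' = a} (_ , _ , ¬ab)) _ = ⊥-elim (¬ab (refl , refl))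
        others-blue (diamond {j' = b} (b≢b , _)) _ = ⊥-elim (b≢b refl)
        others-blue (diamond {j' = c} _) _ = c-initial i'
        others-blue (diamond {j' = d} _) ne = ⊥-elim (ne refl)
        others-blue (left i''i') _ rewrite NextMod-injective i''i' ii' = block-blue a
      a'-blue : Blue₀ (vertex i' a)
      a'-blue = force-from-spine i' c-spine (λ ()) (c-initial i') mates-blue
        where
        mates-blue : ∀ j' → j' ≢ c → j' ≢ a → Blue₀ (vertex i' j')
        mates-blue a _ j'≢a = ⊥-elim (j'≢a refl)
        mates-blue b _ _ = b'-blue
        mates-blue c j'≢c _ = ⊥-elim (j'≢c refl)
        mates-blue d _ _ = d'-blue

  initial-set-forcing : ZeroForcingSet (Necklace k) initial-set
  initial-set-forcing v with decompose v
  ... | at i j = <-weakInduction BlueBlock first-block-blue step i j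
    where
    step : ∀ i → BlueBlock (inject₁ i) → BlueBlock (suc i)
    step i = next-block-blue (inj₁ (cong suc (sym (toℕ-inject₁ i))))

  necklace-zeroForcingNumber : IsZeroForcingNumber (Necklace k) (k + 2)
  necklace-zeroForcingNumber =
    (initial-set , initial-set-forcing , ∣initial-set∣) , λ S zfs → zeroForcingSet⇒k+2≤∣S∣ zfs zero

module _ where

  open NecklaceGraph {1}

  single-diamond-∼ : ∀ {j j'} → j ≢ j' → (zero , j) ∼ (zero , j')
  single-diamond-∼ {j} {j'} j≢j' with tip-or-spine j | tip-or-spine j'
  ... | inj₂ j-spine | _ = ∼-spine (inj₁ j-spine) j≢j'
  ... | inj₁ _ | inj₂ j'-spine = ∼-spine (inj₂ j'-spine) j≢j'
  ... | inj₁ a-tip | inj₁ a-tip = ⊥-elim (j≢j' refl)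
  ... | inj₁ a-tip | inj₁ b-tip = right (inj₂ (refl , refl))
  ... | inj₁ b-tip | inj₁ a-tip = left (inj₂ (refl , refl))
  ... | inj₁ b-tip | inj₁ b-tip = ⊥-elim (j≢j' refl)

  K4-as-necklace : ∀ {u v} → Adj (Necklace 1) u v ⇔ Adj K4 u v
  K4-as-necklace {u} {v} = mk⇔ (λ { uv refl → adj-irrefl {u} uv }) (≢⇒adj (decompose u) (decompose v))
    where
    ≢⇒adj : ∀ {u v} → Decomposition u → Decomposition v → u ≢ v → Adj (Necklace 1) u v
    ≢⇒adj (at zero j) (at zero j') u≢v = ∼⇒adj (single-diamond-∼ (u≢v ∘ cong (vertex zero)))

K4-dominationNumber : IsDominationNumber K4 1
K4-dominationNumber = dominationNumber-transfer (Necklace 1) K4-as-necklace NecklaceGraph.dominationNumber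

K4-zeroForcingNumber : IsZeroForcingNumber K4 3
K4-zeroForcingNumber = zeroForcingNumber-transfer (Necklace 1) K4-as-necklace (necklace-zeroForcingNumber 0)

NCubicStar-invariants : ∀ {G} → NCubicStar G →
  ∃ λ g → IsDominationNumber G g × IsZeroForcingNumber G (g + 2)
NCubicStar-invariants (necklace (suc k') _) =
  suc k' , NecklaceGraph.dominationNumber , necklace-zeroForcingNumber k'
NCubicStar-invariants k4 = 1 , K4-dominationNumber , K4-zeroForcingNumber

lemma2p5 : (G : Graph) → NCubicStar G → (g z : ℕ) →
    IsDominationNumber G g → IsZeroForcingNumber G z → z ≡ g + 2
lemma2p5 G G∈N g z γ≡g Z≡z =
  let (g' , γ≡g' , Z≡g'+2) = NCubicStar-invariants G∈N in
  trans (minimumSize-unique Z≡z Z≡g'+2) (cong (_+ 2) (minimumSize-unique γ≡g' γ≡g))
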